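{- Let $(F_n)_{n\in\mathbb{Z}}$ be the Fibonacci numbers and $(G_n)_{n\in\mathbb{Z}}$ a Fibonacci-like sequence. Let $a,b,m,n$ be integers and $k$ a non-negative integer. Each of the following six identities holds whenever the denominators occurring in its summand are nonzero for all $0\le j\le k$: \[ (-1)^{a+b+1}F_{m-a}G_nG_{n-(m-a)(k+1)}\sum_{j=0}^k\frac{F_{a-b}^{k-j}F_{m-b}^{j}G_{n-m+b-(m-a)k+(m-a)j}}{G_{n-(m-a)k+(m-a)j}\,G_{n-(m-a)-(m-a)k+(m-a)j}}=F_{a-b}^{k+1}G_n-F_{m-b}^{k+1}G_{n-(m-a)(k+1)}, \] \[ F_{m-b}G_nG_{n-(m-b)(k+1)}\sum_{j=0}^k\frac{(-1)^{(a+b+1)j}F_{a-b}^{k-j}F_{m-a}^{j}G_{n-(m-a)-(m-b)k+(m-b)j}}{G_{n-(m-b)k+(m-b)j}\,G_{n-(m-b)-(m-b)k+(m-b)j}}=F_{a-b}^{k+1}G_n-(-1)^{(a+b+1)(k+1)}F_{m-a}^{k+1}G_{n-(m-b)(k+1)}, \] \[ F_{a-b}G_nG_{n-(a-b)(k+1)}\sum_{j=0}^k\frac{(-1)^{(a+b)j}F_{m-b}^{k-j}F_{m-a}^{j}G_{n+m-a-(a-b)k+(a-b)j}}{G_{n-(a-b)k+(a-b)j}\,G_{n-(a-b)-(a-b)k+(a-b)j}}=F_{m-b}^{k+1}G_n-(-1)^{(a+b)(k+1)}F_{m-a}^{k+1}G_{n-(a-b)(k+1)}, \] \[ (-1)^{a+b+1}F_{m+b}G_nG_{n-(m+b)(k+1)}\sum_{j=0}^k\frac{F_{a-b}^{k-j}F_{m+a}^{j}G_{n-m-a-(m+b)k+(m+b)j}}{G_{n-(m+b)k+(m+b)j}\,G_{n-(m+b)-(m+b)k+(m+b)j}}=F_{a-b}^{k+1}G_n-F_{m+a}^{k+1}G_{n-(m+b)(k+1)},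 \] \[ F_{m+a}G_nG_{n-(m+a)(k+1)}\sum_{j=0}^k\frac{(-1)^{(a+b+1)j}F_{a-b}^{k-j}F_{m+b}^{j}G_{n-(m+b)-(m+a)k+(m+a)j}}{G_{n-(m+a)k+(m+a)j}\,G_{n-(m+a)-(m+a)k+(m+a)j}}=F_{a-b}^{k+1}G_n-(-1)^{(a+b+1)(k+1)}F_{m+b}^{k+1}G_{n-(m+a)(k+1)}, \] \[ F_{a-b}G_nG_{n-(a-b)(k+1)}\sum_{j=0}^k\frac{(-1)^{(a+b)j}F_{m+a}^{k-j}F_{m+b}^{j}G_{n+m+b-(a-b)k+(a-b)j}}{G_{n-(a-b)k+(a-b)j}\,G_{n-(a-b)-(a-b)k+(a-b)j}}=F_{m+a}^{k+1}G_n-(-1)^{(a+b)(k+1)}F_{m+b}^{k+1}G_{n-(a-b)(k+1)}. \]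
   Context: The Fibonacci numbers are defined by $F_0=0$, $F_1=1$, $F_n=F_{n-1}+F_{n-2}$ for $n\ge 2$, and $F_{ -n}=(-1)^{n-1}F_n$. A Fibonacci-like sequence $(G_n)_{n\in\mathbb{Z}}$ is defined by arbitrary integers $G_0,G_1$, not both zero, with $G_n=G_{n-1}+G_{n-2}$ for $n\ge 2$, extended to negative indices by $G_{ -n}=G_{ -n+2}-G_{ -n+1}$. The convention $0^0=1$ is used for powers. -}

module Defs where

open import Data.Nat as ℕ using (ℕ; zero; suc)
open import Data.Integer as ℤ using (ℤ; +_; -[1+_]; +[1+_]; _+_; _-_; _*_; -_; ∣_∣)
open import Data.Product using (_×_; _,_; proj₁)
open import Data.Rational as ℚ using (ℚ; 0ℚ)

fibℕ : ℕ → ℕ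
fibℕ zero = zero
fibℕ (suc zero) = suc zero
fibℕ (suc (suc n)) = fibℕ (suc n) ℕ.+ fibℕ n

-- (-1)^z for an integer exponent z (depends only on the parity of z)
sgn : ℤ → ℤ
sgn z = (ℤ.- + 1) ℤ.^ ∣ z ∣

-- Fibonacci numbers on ℤ : F_{-n} = (-1)^(n-1) F_n
F : ℤ → ℤ
F (+ n) = + fibℕ n
F -[1+ n ] = (ℤ.- + 1) ℤ.^ n * + fibℕ (suc n)

-- forward pairs (G_n , G_{n+1}) for n ≥ 0
Gfwd : ℤ → ℤ → ℕ → ℤ × ℤ
Gfwd g0 g1 zero = g0 , g1
Gfwd g0 g1 (suc n) with Gfwd g0 g1 n
... | x , y = y , x + y

-- backward pairs (G_{-n} , G_{-n+1}) for n ≥ 0, using G_{-n-1} = G_{-n+1} - G_{-n}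
Gbwd : ℤ → ℤ → ℕ → ℤ × ℤ
Gbwd g0 g1 zero = g0 , g1
Gbwd g0 g1 (suc n) with Gbwd g0 g1 n
... | x , y = y - x , x

G : ℤ → ℤ → ℤ → ℤ
G g0 g1 (+ n) = proj₁ (Gfwd g0 g1 n)
G g0 g1 -[1+ n ] = proj₁ (Gbwd g0 g1 (suc n))

-- integer quotient p / q as a rational; total (value 0 when q = 0,
-- which never matters since the theorem assumes q ≠ 0)
infixl 7 _⊘_
_⊘_ : ℤ → ℤ → ℚ
p ⊘ (+ zero) = 0ℚ
p ⊘ (+[1+ n ]) = p ℚ./ suc n
p ⊘ (-[1+ n ]) = (- p) ℚ./ suc n

Σ₀ : ℕ → (ℕ → ℚ) → ℚ
Σ₀ zero f = f zero
Σ₀ (suc k) f = Σ₀ k f ℚ.+ f (suc k)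

toℚ : ℤ → ℚ
toℚ z = z ℚ./ 1

-- Every identity is a telescoping sum.  Let P_j and Q_j = P_{j-1} be the two values of G in the
-- j-th denominator, and suppose G satisfies a three-term relation A G_y - B G_{y-d} = X G_{y'}
-- whose right-hand side is the G-value of the j-th numerator.  Then X times the j-th summand is
-- A^{k-j} B^j (A P_j - B Q_j) / (P_j Q_j) = t_j - t_{j+1} with t_j = A^{k+1-j} B^j / Q_j, and the
-- sum collapses to t_0 - t_{k+1}.  All the three-term relations needed are rearrangements of
-- Vajda's identity F_u G_{u+w+p} - F_{u+w} G_{u+p} = (-1)^{u+1} F_w G_p with u = a - b, which
-- follows from the addition formula G_{x+y} = F_{x+1} G_y + F_x G_{y-1} and Cassini's identity.
-- Identities (4)-(6) are (1)-(3) with (m - a, m - b) replaced by (m + b, m + a).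

module Submission where

open import Defs
open import Data.Nat as ℕ using (ℕ; _≤_; _∸_)
open import Data.Integer as ℤ using (ℤ; +_; _+_; _-_; _*_; _^_)
open import Data.Rational as ℚ using (ℚ)
open import Data.Product using (_×_)
open import Relation.Binary.PropositionalEquality using (_≡_; _≢_)
open import Relation.Nullary using (¬_)

open import Data.Empty using (⊥-elim)
open import Data.Nat using (zero; suc; z≤n)
import Data.Nat.Properties as ℕP
open import Data.Integer using (-[1+_]; +[1+_]; -_)
import Data.Integer.Properties as ℤP
open import Data.Integer.Tactic.RingSolver using (solve-∀)
import Data.Rational.Properties as ℚP
open import Data.Rational.Solver using (module +-*-Solver)
open import Data.Rational.Unnormalised as ℚᵘ using (mkℚᵘ; *≡*)
import Data.Rational.Unnormalised.Properties as ℚᵘP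
open import Data.Product using (_,_; proj₁; proj₂)
open import Relation.Binary.PropositionalEquality using (refl; sym; trans; cong; cong₂; subst; module ≡-Reasoning)

open +-*-Solver
open ≡-Reasoning

fromℚᵘ-homo-+ : ∀ x y → ℚ.fromℚᵘ (x ℚᵘ.+ y) ≡ ℚ.fromℚᵘ x ℚ.+ ℚ.fromℚᵘ y
fromℚᵘ-homo-+ x y = trans
  (ℚP.fromℚᵘ-cong (ℚᵘP.≃-trans
    (ℚᵘP.+-cong (ℚᵘP.≃-sym (ℚP.toℚᵘ-fromℚᵘ x)) (ℚᵘP.≃-sym (ℚP.toℚᵘ-fromℚᵘ y)))
    (ℚᵘP.≃-sym (ℚP.toℚᵘ-homo-+ (ℚ.fromℚᵘ x) (ℚ.fromℚᵘ y)))))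
  (ℚP.fromℚᵘ-toℚᵘ _)

fromℚᵘ-homo-* : ∀ x y → ℚ.fromℚᵘ (x ℚᵘ.* y) ≡ ℚ.fromℚᵘ x ℚ.* ℚ.fromℚᵘ y
fromℚᵘ-homo-* x y = trans
  (ℚP.fromℚᵘ-cong (ℚᵘP.≃-trans
    (ℚᵘP.*-cong (ℚᵘP.≃-sym (ℚP.toℚᵘ-fromℚᵘ x)) (ℚᵘP.≃-sym (ℚP.toℚᵘ-fromℚᵘ y)))
    (ℚᵘP.≃-sym (ℚP.toℚᵘ-homo-* (ℚ.fromℚᵘ x) (ℚ.fromℚᵘ y)))))
  (ℚP.fromℚᵘ-toℚᵘ _)

fromℚᵘ-homo‿- : ∀ x → ℚ.fromℚᵘ (ℚᵘ.- x) ≡ ℚ.- ℚ.fromℚᵘ x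
fromℚᵘ-homo‿- x = trans
  (ℚP.fromℚᵘ-cong (ℚᵘP.≃-trans
    (ℚᵘP.-‿cong (ℚᵘP.≃-sym (ℚP.toℚᵘ-fromℚᵘ x)))
    (ℚᵘP.≃-sym (ℚP.toℚᵘ-homo‿- (ℚ.fromℚᵘ x)))))
  (ℚP.fromℚᵘ-toℚᵘ _)

toℚ-+ : ∀ x y → toℚ (x + y) ≡ toℚ x ℚ.+ toℚ y
toℚ-+ x y = trans (ℚP.fromℚᵘ-cong {mkℚᵘ (x + y) 0} {mkℚᵘ x 0 ℚᵘ.+ mkℚᵘ y 0} (*≡* (+-over-1 x y))) (fromℚᵘ-homo-+ (mkℚᵘ x 0) (mkℚᵘ y 0))
  where
  +-over-1 : ∀ x y → (x + y) * + 1 ≡ (x * + 1 + y * + 1) * + 1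
  +-over-1 = solve-∀

toℚ-* : ∀ x y → toℚ (x * y) ≡ toℚ x ℚ.* toℚ y
toℚ-* x y = fromℚᵘ-homo-* (mkℚᵘ x 0) (mkℚᵘ y 0)

toℚ-- : ∀ x y → toℚ (x - y) ≡ toℚ x ℚ.- toℚ y
toℚ-- x y = trans (toℚ-+ x (- y)) (cong (toℚ x ℚ.+_) (fromℚᵘ-homo‿- (mkℚᵘ y 0)))

toℚ-*-⊘-cancel : ∀ {q} p → q ≢ + 0 → toℚ q ℚ.* (p ⊘ q) ≡ toℚ p
toℚ-*-⊘-cancel {+ zero} p q≢0 = ⊥-elim (q≢0 refl)
toℚ-*-⊘-cancel {q@(+[1+ n ])} p _ = trans (sym (fromℚᵘ-homo-* (mkℚᵘ q 0) (mkℚᵘ p n)))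
  (ℚP.fromℚᵘ-cong {mkℚᵘ q 0 ℚᵘ.* mkℚᵘ p n} {mkℚᵘ p 0} (*≡* cross-multiplied))
  where
  cross-multiplied : (q * p) * + 1 ≡ p * + (1 ℕ.* suc n)
  cross-multiplied rewrite ℕP.*-identityˡ (suc n) = ring p q
    where
    ring : ∀ p q → (q * p) * + 1 ≡ p * q
    ring = solve-∀
toℚ-*-⊘-cancel {q@(-[1+ n ])} p _ = trans (sym (fromℚᵘ-homo-* (mkℚᵘ q 0) (mkℚᵘ (- p) n)))
  (ℚP.fromℚᵘ-cong {mkℚᵘ q 0 ℚᵘ.* mkℚᵘ (- p) n} {mkℚᵘ p 0} (*≡* cross-multiplied))
  where
  cross-multiplied : (q * - p) * + 1 ≡ p * + (1 ℕ.* suc n)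
  cross-multiplied rewrite ℕP.*-identityˡ (suc n) = ring p +[1+ n ]
    where
    ring : ∀ p q → (- q * - p) * + 1 ≡ p * q
    ring = solve-∀

toℚ-*-cancelˡ : ∀ {c} x y → c ≢ + 0 → toℚ c ℚ.* x ≡ toℚ c ℚ.* y → x ≡ y
toℚ-*-cancelˡ {c} x y c≢0 cx≡cy = begin
  x                          ≡⟨ sym (c⁻¹*[c*z]≡z x) ⟩
  c⁻¹ ℚ.* (toℚ c ℚ.* x)      ≡⟨ cong (c⁻¹ ℚ.*_) cx≡cy ⟩
  c⁻¹ ℚ.* (toℚ c ℚ.* y)      ≡⟨ c⁻¹*[c*z]≡z y ⟩
  y                          ∎
  where
  c⁻¹ = + 1 ⊘ c
  c⁻¹*[c*z]≡z : ∀ z → c⁻¹ ℚ.* (toℚ c ℚ.* z) ≡ z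
  c⁻¹*[c*z]≡z z = begin
    c⁻¹ ℚ.* (toℚ c ℚ.* z)    ≡⟨ solve 3 (λ a b z → b :* (a :* z) := (a :* b) :* z) refl (toℚ c) c⁻¹ z ⟩
    toℚ c ℚ.* c⁻¹ ℚ.* z      ≡⟨ cong (ℚ._* z) (toℚ-*-⊘-cancel (+ 1) c≢0) ⟩
    ℚ.1ℚ ℚ.* z               ≡⟨ ℚP.*-identityˡ z ⟩
    z                        ∎

i*j≢0⇒i≢0 : ∀ {i} j → i * j ≢ + 0 → i ≢ + 0
i*j≢0⇒i≢0 j ij≢0 refl = ij≢0 refl

i*j≢0⇒j≢0 : ∀ i {j} → i * j ≢ + 0 → j ≢ + 0
i*j≢0⇒j≢0 i ij≢0 refl = ij≢0 (ℤP.*-zeroʳ i)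

toℚ-*-⊘-assoc : ∀ x w {r} → r ≢ + 0 → toℚ x ℚ.* (w ⊘ r) ≡ (x * w) ⊘ r
toℚ-*-⊘-assoc x w {r} r≢0 = toℚ-*-cancelˡ _ _ r≢0 (begin
  toℚ r ℚ.* (toℚ x ℚ.* (w ⊘ r))  ≡⟨ solve 3 (λ r x e → r :* (x :* e) := x :* (r :* e)) refl (toℚ r) (toℚ x) (w ⊘ r) ⟩
  toℚ x ℚ.* (toℚ r ℚ.* (w ⊘ r))  ≡⟨ cong (toℚ x ℚ.*_) (toℚ-*-⊘-cancel w r≢0) ⟩
  toℚ x ℚ.* toℚ w                ≡⟨ sym (toℚ-* x w) ⟩
  toℚ (x * w)                    ≡⟨ sym (toℚ-*-⊘-cancel (x * w) r≢0) ⟩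
  toℚ r ℚ.* ((x * w) ⊘ r)        ∎)

clear-denominators : ∀ a b {p q} → p ≢ + 0 → q ≢ + 0 →
                     toℚ (p * q) ℚ.* (a ⊘ q ℚ.- b ⊘ p) ≡ toℚ (a * p - b * q)
clear-denominators a b {p} {q} p≢0 q≢0 = begin
  toℚ (p * q) ℚ.* (a ⊘ q ℚ.- b ⊘ p)
    ≡⟨ cong (ℚ._* (a ⊘ q ℚ.- b ⊘ p)) (toℚ-* p q) ⟩
  toℚ p ℚ.* toℚ q ℚ.* (a ⊘ q ℚ.- b ⊘ p)
    ≡⟨ solve 4 (λ p q x y → p :* q :* (x :- y) := (q :* x) :* p :- (p :* y) :* q) refl (toℚ p) (toℚ q) (a ⊘ q) (b ⊘ p) ⟩
  toℚ q ℚ.* (a ⊘ q) ℚ.* toℚ p ℚ.- toℚ p ℚ.* (b ⊘ p) ℚ.* toℚ q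
    ≡⟨ cong₂ (λ x y → x ℚ.* toℚ p ℚ.- y ℚ.* toℚ q) (toℚ-*-⊘-cancel a q≢0) (toℚ-*-⊘-cancel b p≢0) ⟩
  toℚ a ℚ.* toℚ p ℚ.- toℚ b ℚ.* toℚ q
    ≡⟨ sym (cong₂ ℚ._-_ (toℚ-* a p) (toℚ-* b q)) ⟩
  toℚ (a * p) ℚ.- toℚ (b * q)
    ≡⟨ sym (toℚ-- (a * p) (b * q)) ⟩
  toℚ (a * p - b * q) ∎

partial-fractions : ∀ a b p q → p * q ≢ + 0 → (a * p - b * q) ⊘ (p * q) ≡ a ⊘ q ℚ.- b ⊘ p
partial-fractions a b p q pq≢0 = toℚ-*-cancelˡ _ _ pq≢0
  (trans (toℚ-*-⊘-cancel (a * p - b * q) pq≢0)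
         (sym (clear-denominators a b (i*j≢0⇒i≢0 q pq≢0) (i*j≢0⇒j≢0 p pq≢0))))

Σ₀-cong : ∀ k {f g : ℕ → ℚ} → (∀ j → j ≤ k → f j ≡ g j) → Σ₀ k f ≡ Σ₀ k g
Σ₀-cong zero    f≗g = f≗g 0 z≤n
Σ₀-cong (suc k) f≗g =
  cong₂ ℚ._+_ (Σ₀-cong k (λ j j≤k → f≗g j (ℕP.m≤n⇒m≤1+n j≤k))) (f≗g (suc k) ℕP.≤-refl)

*-distribˡ-Σ₀ : ∀ k c (f : ℕ → ℚ) → c ℚ.* Σ₀ k f ≡ Σ₀ k (λ j → c ℚ.* f j)
*-distribˡ-Σ₀ zero    c f = refl
*-distribˡ-Σ₀ (suc k) c f =
  trans (ℚP.*-distribˡ-+ c (Σ₀ k f) (f (suc k))) (cong (ℚ._+ c ℚ.* f (suc k)) (*-distribˡ-Σ₀ k c f))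

Σ₀-telescoping : ∀ k (t : ℕ → ℚ) → Σ₀ k (λ j → t j ℚ.- t (suc j)) ≡ t 0 ℚ.- t (suc k)
Σ₀-telescoping zero    t = refl
Σ₀-telescoping (suc k) t = trans
  (cong (ℚ._+ (t (suc k) ℚ.- t (suc (suc k)))) (Σ₀-telescoping k t))
  (solve 3 (λ a b c → (a :- b) :+ (b :- c) := a :- c) refl (t 0) (t (suc k)) (t (suc (suc k))))

Σ₀-partial-fractions : ∀ k (P Q u : ℕ → ℤ) → (∀ j → Q (suc j) ≡ P j) → (∀ j → j ≤ k → P j * Q j ≢ + 0) →
  Σ₀ k (λ j → (u j * P j - u (suc j) * Q j) ⊘ (P j * Q j)) ≡ u 0 ⊘ Q 0 ℚ.- u (suc k) ⊘ P k
Σ₀-partial-fractions k P Q u Q[1+j]≡Pj PQ≢0 = begin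
  Σ₀ k (λ j → (u j * P j - u (suc j) * Q j) ⊘ (P j * Q j))
    ≡⟨ Σ₀-cong k (λ j j≤k → partial-fractions (u j) (u (suc j)) (P j) (Q j) (PQ≢0 j j≤k)) ⟩
  Σ₀ k (λ j → u j ⊘ Q j ℚ.- u (suc j) ⊘ P j)
    ≡⟨ Σ₀-cong k (λ j _ → cong (λ r → u j ⊘ Q j ℚ.- u (suc j) ⊘ r) (sym (Q[1+j]≡Pj j))) ⟩
  Σ₀ k (λ j → u j ⊘ Q j ℚ.- u (suc j) ⊘ Q (suc j))
    ≡⟨ Σ₀-telescoping k (λ j → u j ⊘ Q j) ⟩
  u 0 ⊘ Q 0 ℚ.- u (suc k) ⊘ Q (suc k)
    ≡⟨ cong (λ r → u 0 ⊘ Q 0 ℚ.- u (suc k) ⊘ r) (Q[1+j]≡Pj k) ⟩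
  u 0 ⊘ Q 0 ℚ.- u (suc k) ⊘ P k ∎

geometric-weight : ∀ A B p q {j k} → j ≤ k →
  A ^ (k ∸ j) * B ^ j * (A * p - B * q) ≡ A ^ (suc k ∸ j) * B ^ j * p - A ^ (suc k ∸ suc j) * B ^ suc j * q
geometric-weight A B p q {j} {k} j≤k = begin
  A ^ (k ∸ j) * B ^ j * (A * p - B * q)                    ≡⟨ distribute (A ^ (k ∸ j)) (B ^ j) A B p q ⟩
  A ^ suc (k ∸ j) * B ^ j * p - A ^ (k ∸ j) * B ^ suc j * q ≡⟨ cong (λ e → A ^ e * B ^ j * p - A ^ (k ∸ j) * B ^ suc j * q) (sym (ℕP.+-∸-assoc 1 j≤k)) ⟩
  A ^ (suc k ∸ j) * B ^ j * p - A ^ (k ∸ j) * B ^ suc j * q ∎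
  where
  distribute : ∀ x y a b p q → x * y * (a * p - b * q) ≡ a * x * y * p - x * (b * y) * q
  distribute = solve-∀

Σ₀-geometric-telescoping : ∀ k (P Q : ℕ → ℤ) (X A B : ℤ) {W : ℕ → ℤ} →
  (∀ j → Q (suc j) ≡ P j) → (∀ j → j ≤ k → P j * Q j ≢ + 0) →
  (∀ j → j ≤ k → X * W j ≡ A ^ (k ∸ j) * B ^ j * (A * P j - B * Q j)) →
  toℚ (P k * Q 0 * X) ℚ.* Σ₀ k (λ j → W j ⊘ (P j * Q j)) ≡ toℚ (A ^ suc k * P k - B ^ suc k * Q 0)
Σ₀-geometric-telescoping k P Q X A B {W} Q[1+j]≡Pj PQ≢0 weights = begin
  toℚ (P k * Q 0 * X) ℚ.* Σ₀ k (λ j → W j ⊘ (P j * Q j))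
    ≡⟨ trans (cong (ℚ._* Σ₀ k (λ j → W j ⊘ (P j * Q j))) (toℚ-* (P k * Q 0) X))
             (ℚP.*-assoc (toℚ (P k * Q 0)) (toℚ X) _) ⟩
  toℚ (P k * Q 0) ℚ.* (toℚ X ℚ.* Σ₀ k (λ j → W j ⊘ (P j * Q j)))
    ≡⟨ cong (toℚ (P k * Q 0) ℚ.*_) (trans (*-distribˡ-Σ₀ k (toℚ X) _) (Σ₀-cong k summands)) ⟩
  toℚ (P k * Q 0) ℚ.* Σ₀ k (λ j → (u j * P j - u (suc j) * Q j) ⊘ (P j * Q j))
    ≡⟨ cong (toℚ (P k * Q 0) ℚ.*_) (Σ₀-partial-fractions k P Q u Q[1+j]≡Pj PQ≢0) ⟩
  toℚ (P k * Q 0) ℚ.* (u 0 ⊘ Q 0 ℚ.- u (suc k) ⊘ P k)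
    ≡⟨ clear-denominators (u 0) (u (suc k)) (i*j≢0⇒i≢0 (Q k) (PQ≢0 k ℕP.≤-refl)) (i*j≢0⇒j≢0 (P 0) (PQ≢0 0 z≤n)) ⟩
  toℚ (u 0 * P k - u (suc k) * Q 0)
    ≡⟨ cong₂ (λ x y → toℚ (x * P k - y * Q 0)) (ℤP.*-identityʳ (A ^ suc k)) u[1+k]≡B^[1+k] ⟩
  toℚ (A ^ suc k * P k - B ^ suc k * Q 0) ∎
  where
  u : ℕ → ℤ
  u j = A ^ (suc k ∸ j) * B ^ j

  u[1+k]≡B^[1+k] : u (suc k) ≡ B ^ suc k
  u[1+k]≡B^[1+k] = trans (cong (λ e → A ^ e * B ^ suc k) (ℕP.n∸n≡0 k)) (ℤP.*-identityˡ (B ^ suc k))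

  summands : ∀ j → j ≤ k → toℚ X ℚ.* (W j ⊘ (P j * Q j)) ≡ (u j * P j - u (suc j) * Q j) ⊘ (P j * Q j)
  summands j j≤k = trans (toℚ-*-⊘-assoc X (W j) (PQ≢0 j j≤k))
    (cong (_⊘ (P j * Q j)) (trans (weights j j≤k) (geometric-weight A B (P j) (Q j) j≤k)))

telescoping-identity : ∀ (g h : ℤ → ℤ) (X A B d n : ℤ) (k : ℕ) {W : ℕ → ℤ} →
  (∀ y → A * g y - B * g (y - d) ≡ X * h y) →
  (∀ j → W j ≡ A ^ (k ∸ j) * B ^ j * h (n - d * + k + d * + j)) →
  (∀ j → j ≤ k → g (n - d * + k + d * + j) * g (n - d - d * + k + d * + j) ≢ + 0) →
  toℚ (X * g n * g (n - d * (+ k + + 1)))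
    ℚ.* Σ₀ k (λ j → W j ⊘ (g (n - d * + k + d * + j) * g (n - d - d * + k + d * + j)))
    ≡ toℚ (A ^ suc k * g n - B ^ suc k * g (n - d * (+ k + + 1)))
telescoping-identity g h X A B d n k {W} relation W≡ PQ≢0 = begin
  toℚ (X * g n * g n′) ℚ.* Σ₀ k (λ j → W j ⊘ (P j * Q j))
    ≡⟨ cong (λ z → toℚ z ℚ.* Σ₀ k (λ j → W j ⊘ (P j * Q j))) prefactor ⟩
  toℚ (P k * Q 0 * X) ℚ.* Σ₀ k (λ j → W j ⊘ (P j * Q j))
    ≡⟨ Σ₀-geometric-telescoping k P Q X A B Q[1+j]≡Pj PQ≢0 weights ⟩
  toℚ (A ^ suc k * P k - B ^ suc k * Q 0)
    ≡⟨ cong₂ (λ p q → toℚ (A ^ suc k * p - B ^ suc k * q)) Pk≡gn Q0≡gn′ ⟩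
  toℚ (A ^ suc k * g n - B ^ suc k * g n′) ∎
  where
  n′ = n - d * (+ k + + 1)
  P Q : ℕ → ℤ
  P j = g (n - d * + k + d * + j)
  Q j = g (n - d - d * + k + d * + j)

  Q[1+j]≡Pj : ∀ j → Q (suc j) ≡ P j
  Q[1+j]≡Pj j = cong g (index-shift n d (+ k) (+ j))
    where
    index-shift : ∀ n d K J → n - d - d * K + d * (+ 1 + J) ≡ n - d * K + d * J
    index-shift = solve-∀

  Pk≡gn : P k ≡ g n
  Pk≡gn = cong g (index-top n d (+ k))
    where
    index-top : ∀ n d K → n - d * K + d * K ≡ n
    index-top = solve-∀

  Q0≡gn′ : Q 0 ≡ g n′
  Q0≡gn′ = cong g (index-bottom n d (+ k))
    where
    index-bottom : ∀ n d K → n - d - d * K + d * + 0 ≡ n - d * (K + + 1)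
    index-bottom = solve-∀

  prefactor : X * g n * g n′ ≡ P k * Q 0 * X
  prefactor = trans (cong₂ (λ p q → X * p * q) (sym Pk≡gn) (sym Q0≡gn′)) (rotate X (P k) (Q 0))
    where
    rotate : ∀ x p q → x * p * q ≡ p * q * x
    rotate = solve-∀

  weights : ∀ j → j ≤ k → X * W j ≡ A ^ (k ∸ j) * B ^ j * (A * P j - B * Q j)
  weights j _ = begin
    X * W j                                 ≡⟨ cong (X *_) (W≡ j) ⟩
    X * (A ^ (k ∸ j) * B ^ j * h y)         ≡⟨ rotate X (A ^ (k ∸ j) * B ^ j) (h y) ⟩
    A ^ (k ∸ j) * B ^ j * (X * h y)         ≡⟨ cong (A ^ (k ∸ j) * B ^ j *_) (sym (relation y)) ⟩
    A ^ (k ∸ j) * B ^ j * (A * P j - B * g (y - d))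
      ≡⟨ cong (λ z → A ^ (k ∸ j) * B ^ j * (A * P j - B * g z)) (index-down n d (+ k) (+ j)) ⟩
    A ^ (k ∸ j) * B ^ j * (A * P j - B * Q j) ∎
    where
    y = n - d * + k + d * + j
    rotate : ∀ x c e → x * (c * e) ≡ c * (x * e)
    rotate = solve-∀
    index-down : ∀ n d K J → n - d * K + d * J - d ≡ n - d - d * K + d * J
    index-down = solve-∀

m+[n-m]≡n : ∀ m n → m + (n - m) ≡ n
m+[n-m]≡n = solve-∀

m+n-m≡n : ∀ m n → m + n - m ≡ n
m+n-m≡n = solve-∀

i-j≡k⇒i-k≡j : ∀ i {j k} → i - j ≡ k → i - k ≡ j
i-j≡k⇒i-k≡j i {j} refl = i-[i-j]≡j i j
  where
  i-[i-j]≡j : ∀ i j → i - (i - j) ≡ j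
  i-[i-j]≡j = solve-∀

i-j≡-k⇒j-k≡i : ∀ {i j} k → i - j ≡ - k → j - k ≡ i
i-j≡-k⇒j-k≡i {i} {j} k i-j≡-k = begin
  j - k           ≡⟨ cong (λ x → j - x) (sym (ℤP.neg-involutive k)) ⟩
  j - - - k       ≡⟨ cong (λ x → j - - x) (sym i-j≡-k) ⟩
  j - - (i - j)   ≡⟨ j+[i-j]≡i i j ⟩
  i               ∎
  where
  j+[i-j]≡i : ∀ i j → j - - (i - j) ≡ i
  j+[i-j]≡i = solve-∀

reindex : ∀ {n′} n e → n′ ≡ n + e → ∀ d K J → n′ - d * K + d * J ≡ n - d * K + d * J + e
reindex n e refl d K J = shift n e d K J
  where
  shift : ∀ n e d K J → n + e - d * K + d * J ≡ n - d * K + d * J + e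
  shift = solve-∀

ℤ-induction : (P : ℤ → Set) → P (+ 0) → (∀ z → P z → P (z + + 1)) → (∀ z → P (z + + 1) → P z) → ∀ z → P z
ℤ-induction P P0 up down (+ zero)        = P0
ℤ-induction P P0 up down (+ suc n)       = subst P (cong +_ (ℕP.+-comm n 1)) (up (+ n) (ℤ-induction P P0 up down (+ n)))
ℤ-induction P P0 up down -[1+ zero ]     = down -[1+ 0 ] P0
ℤ-induction P P0 up down -[1+ suc n ]    = down -[1+ suc n ] (ℤ-induction P P0 up down -[1+ n ])

sgn-suc : ∀ z → sgn (z + + 1) ≡ - sgn z
sgn-suc (+ n) rewrite ℕP.+-comm n 1 = ℤP.-1*i≡-i (sgn (+ n))
sgn-suc -[1+ zero ]  = refl
sgn-suc -[1+ suc n ] = sym (trans (cong -_ (ℤP.-1*i≡-i (sgn -[1+ n ]))) (ℤP.neg-involutive _))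

sgn-neg : ∀ z → sgn (- z) ≡ sgn z
sgn-neg z = cong ((- + 1) ^_) (ℤP.∣-i∣≡∣i∣ z)

sgn-+ : ∀ x y → sgn (x + y) ≡ sgn x * sgn y
sgn-+ x = ℤ-induction (λ y → sgn (x + y) ≡ sgn x * sgn y) base up down
  where
  base : sgn (x + + 0) ≡ sgn x * sgn (+ 0)
  base = trans (cong sgn (ℤP.+-identityʳ x)) (sym (ℤP.*-identityʳ (sgn x)))
  step : ∀ y → sgn (x + (y + + 1)) ≡ - sgn (x + y)
  step y = trans (cong sgn (sym (ℤP.+-assoc x y (+ 1)))) (sgn-suc (x + y))
  up : ∀ y → sgn (x + y) ≡ sgn x * sgn y → sgn (x + (y + + 1)) ≡ sgn x * sgn (y + + 1)
  up y ih = begin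
    sgn (x + (y + + 1))   ≡⟨ step y ⟩
    - sgn (x + y)         ≡⟨ cong -_ ih ⟩
    - (sgn x * sgn y)     ≡⟨ ℤP.neg-distribʳ-* (sgn x) (sgn y) ⟩
    sgn x * - sgn y       ≡⟨ cong (sgn x *_) (sym (sgn-suc y)) ⟩
    sgn x * sgn (y + + 1) ∎
  down : ∀ y → sgn (x + (y + + 1)) ≡ sgn x * sgn (y + + 1) → sgn (x + y) ≡ sgn x * sgn y
  down y ih = begin
    sgn (x + y)               ≡⟨ sym (ℤP.neg-involutive _) ⟩
    - - sgn (x + y)           ≡⟨ cong -_ (sym (step y)) ⟩
    - sgn (x + (y + + 1))     ≡⟨ cong -_ ih ⟩
    - (sgn x * sgn (y + + 1)) ≡⟨ cong (λ s → - (sgn x * s)) (sgn-suc y) ⟩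
    - (sgn x * - sgn y)       ≡⟨ cong -_ (sym (ℤP.neg-distribʳ-* (sgn x) (sgn y))) ⟩
    - - (sgn x * sgn y)       ≡⟨ ℤP.neg-involutive _ ⟩
    sgn x * sgn y             ∎

sgn[x-y]≡sgn[x+y] : ∀ x y → sgn (x - y) ≡ sgn (x + y)
sgn[x-y]≡sgn[x+y] x y = begin
  sgn (x - y)       ≡⟨ sgn-+ x (- y) ⟩
  sgn x * sgn (- y) ≡⟨ cong (sgn x *_) (sgn-neg y) ⟩
  sgn x * sgn y     ≡⟨ sym (sgn-+ x y) ⟩
  sgn (x + y)       ∎

sgn[x*j]≡sgn[x]^j : ∀ x j → sgn (x * + j) ≡ sgn x ^ j
sgn[x*j]≡sgn[x]^j x zero    = cong sgn (ℤP.*-zeroʳ x)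
sgn[x*j]≡sgn[x]^j x (suc j) = begin
  sgn (x * + suc j)      ≡⟨ cong sgn (unfold x (+ j)) ⟩
  sgn (x + x * + j)      ≡⟨ sgn-+ x (x * + j) ⟩
  sgn x * sgn (x * + j)  ≡⟨ cong (sgn x *_) (sgn[x*j]≡sgn[x]^j x j) ⟩
  sgn x * sgn x ^ j      ∎
  where
  unfold : ∀ x j → x * (+ 1 + j) ≡ x + x * j
  unfold = solve-∀

sgn[x-y+1]≡sgn[x+y+1] : ∀ x y → sgn (x - y + + 1) ≡ sgn (x + y + + 1)
sgn[x-y+1]≡sgn[x+y+1] x y = begin
  sgn (x - y + + 1)  ≡⟨ sgn-suc (x - y) ⟩
  - sgn (x - y)      ≡⟨ cong -_ (sgn[x-y]≡sgn[x+y] x y) ⟩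
  - sgn (x + y)      ≡⟨ sym (sgn-suc (x + y)) ⟩
  sgn (x + y + + 1)  ∎

^-distribʳ-* : ∀ x y j → (x * y) ^ j ≡ x ^ j * y ^ j
^-distribʳ-* x y zero    = refl
^-distribʳ-* x y (suc j) = trans (cong (x * y *_) (^-distribʳ-* x y j)) (interchange x y (x ^ j) (y ^ j))
  where
  interchange : ∀ x y p q → x * y * (p * q) ≡ x * p * (y * q)
  interchange = solve-∀

sgn[x*j]*f^j≡[sgn[x]*f]^j : ∀ x f j → sgn (x * + j) * f ^ j ≡ (sgn x * f) ^ j
sgn[x*j]*f^j≡[sgn[x]*f]^j x f j =
  trans (cong (_* f ^ j) (sgn[x*j]≡sgn[x]^j x j)) (sym (^-distribʳ-* (sgn x) f j))

signed-weight : ∀ x c f j → sgn (x * + j) * c * f ^ j ≡ c * (sgn x * f) ^ j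
signed-weight x c f j = trans (swap (sgn (x * + j)) c (f ^ j)) (cong (c *_) (sgn[x*j]*f^j≡[sgn[x]*f]^j x f j))
  where
  swap : ∀ s c p → s * c * p ≡ c * (s * p)
  swap = solve-∀

signed-power : ∀ x f k → sgn (x * (+ k + + 1)) * f ^ suc k ≡ (sgn x * f) ^ suc k
signed-power x f k = trans (cong (λ t → sgn (x * t) * f ^ suc k) (cong +_ (ℕP.+-comm k 1))) (sgn[x*j]*f^j≡[sgn[x]*f]^j x f (suc k))

FibonacciLike : (ℤ → ℤ) → Set
FibonacciLike f = ∀ x → f (x + + 2) ≡ f (x + + 1) + f x

F-fibonacciLike : FibonacciLike F
F-fibonacciLike (+ n) rewrite ℕP.+-comm n 2 | ℕP.+-comm n 1 = refl
F-fibonacciLike -[1+ zero ]        = refl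
F-fibonacciLike -[1+ suc zero ]    = refl
F-fibonacciLike -[1+ suc (suc n) ] = alternate ((- + 1) ^ n) (+ fibℕ (suc n)) (+ fibℕ (suc (suc n)))
  where
  alternate : ∀ s a b → s * a ≡ (- + 1 * s) * b + (- + 1 * (- + 1 * s)) * (b + a)
  alternate = solve-∀

G-fibonacciLike : ∀ g0 g1 → FibonacciLike (G g0 g1)
G-fibonacciLike g0 g1 (+ n) rewrite ℕP.+-comm n 2 | ℕP.+-comm n 1 =
  ℤP.+-comm (proj₁ (Gfwd g0 g1 n)) (proj₂ (Gfwd g0 g1 n))
G-fibonacciLike g0 g1 -[1+ zero ]        = sym (m+[n-m]≡n g0 g1)
G-fibonacciLike g0 g1 -[1+ suc zero ]    = sym (m+[n-m]≡n (g1 - g0) g0)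
G-fibonacciLike g0 g1 -[1+ suc (suc n) ] =
  sym (m+[n-m]≡n (proj₁ (Gbwd g0 g1 (suc (suc n)))) (proj₁ (Gbwd g0 g1 (suc n))))

z+1+1≡z+2 : ∀ z → z + + 1 + + 1 ≡ z + + 2
z+1+1≡z+2 z = ℤP.+-assoc z (+ 1) (+ 1)

module _ {f : ℤ → ℤ} (f-fib : FibonacciLike f) where

  fibonacciLike-pred : ∀ z → f z ≡ f (z + + 2) - f (z + + 1)
  fibonacciLike-pred z = trans (sym (m+n-m≡n (f (z + + 1)) (f z))) (cong (_- f (z + + 1)) (sym (f-fib z)))

  fibonacciLike-shift : ∀ s → FibonacciLike (λ x → f (x + s))
  fibonacciLike-shift s x = begin
    f (x + + 2 + s)             ≡⟨ cong f (swap x (+ 2) s) ⟩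
    f (x + s + + 2)             ≡⟨ f-fib (x + s) ⟩
    f (x + s + + 1) + f (x + s) ≡⟨ cong (λ y → f y + f (x + s)) (swap x s (+ 1)) ⟩
    f (x + + 1 + s) + f (x + s) ∎
    where
    swap : ∀ x a b → x + a + b ≡ x + b + a
    swap = solve-∀

  fibonacciLike-linear : ∀ {g} → FibonacciLike g → ∀ c e → FibonacciLike (λ x → f x * c + g x * e)
  fibonacciLike-linear {g} g-fib c e x rewrite f-fib x | g-fib x =
    regroup (f (x + + 1)) (f x) (g (x + + 1)) (g x) c e
    where
    regroup : ∀ a b a′ b′ c e → (a + b) * c + (a′ + b′) * e ≡ (a * c + a′ * e) + (b * c + b′ * e)
    regroup = solve-∀

fibonacciLike-unique : ∀ {f g} → FibonacciLike f → FibonacciLike g →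
                       f (+ 0) ≡ g (+ 0) → f (+ 1) ≡ g (+ 1) → ∀ x → f x ≡ g x
fibonacciLike-unique {f} {g} f-fib g-fib f0≡g0 f1≡g1 x = proj₁ (ℤ-induction Agree (f0≡g0 , f1≡g1) up down x)
  where
  Agree : ℤ → Set
  Agree z = f z ≡ g z × f (z + + 1) ≡ g (z + + 1)
  up : ∀ z → Agree z → Agree (z + + 1)
  up z (f≡g , f₁≡g₁) = f₁≡g₁ , (begin
    f (z + + 1 + + 1) ≡⟨ cong f (z+1+1≡z+2 z) ⟩
    f (z + + 2)       ≡⟨ f-fib z ⟩
    f (z + + 1) + f z ≡⟨ cong₂ _+_ f₁≡g₁ f≡g ⟩
    g (z + + 1) + g z ≡⟨ sym (g-fib z) ⟩
    g (z + + 2)       ≡⟨ cong g (sym (z+1+1≡z+2 z)) ⟩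
    g (z + + 1 + + 1) ∎)
  down : ∀ z → Agree (z + + 1) → Agree z
  down z (f₁≡g₁ , f₂≡g₂) = (begin
    f z                       ≡⟨ fibonacciLike-pred {f} f-fib z ⟩
    f (z + + 2) - f (z + + 1) ≡⟨ cong₂ _-_ (trans (cong f (sym (z+1+1≡z+2 z))) (trans f₂≡g₂ (cong g (z+1+1≡z+2 z)))) f₁≡g₁ ⟩
    g (z + + 2) - g (z + + 1) ≡⟨ sym (fibonacciLike-pred {g} g-fib z) ⟩
    g z                       ∎) , f₁≡g₁

fibonacciLike-addition : ∀ {f} → FibonacciLike f → ∀ x y → f (x + y) ≡ F (x + + 1) * f y + F x * f (y - + 1)
fibonacciLike-addition {f} f-fib x y = fibonacciLike-unique
  (fibonacciLike-shift {f} f-fib y)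
  (fibonacciLike-linear {λ x → F (x + + 1)} (fibonacciLike-shift {F} F-fibonacciLike (+ 1)) {F} F-fibonacciLike (f y) (f (y - + 1)))
  at-0 at-1 x
  where
  at-0 : f (+ 0 + y) ≡ + 1 * f y + + 0 * f (y - + 1)
  at-0 = trans (cong f (ℤP.+-identityˡ y)) (unit (f y) (f (y - + 1)))
    where
    unit : ∀ a b → a ≡ + 1 * a + + 0 * b
    unit = solve-∀
  at-1 : f (+ 1 + y) ≡ + 1 * f y + + 1 * f (y - + 1)
  at-1 = begin
    f (+ 1 + y)                     ≡⟨ cong f (back-two y) ⟩
    f (y - + 1 + + 2)               ≡⟨ f-fib (y - + 1) ⟩
    f (y - + 1 + + 1) + f (y - + 1) ≡⟨ cong (λ z → f z + f (y - + 1)) (back-one y) ⟩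
    f y + f (y - + 1)               ≡⟨ unit (f y) (f (y - + 1)) ⟩
    + 1 * f y + + 1 * f (y - + 1)   ∎
    where
    back-two : ∀ y → + 1 + y ≡ y - + 1 + + 2
    back-two = solve-∀
    back-one : ∀ y → y - + 1 + + 1 ≡ y
    back-one = solve-∀
    unit : ∀ a b → a + b ≡ + 1 * a + + 1 * b
    unit = solve-∀

cassini : ∀ z → F z * F (z + + 2) - F (z + + 1) * F (z + + 1) ≡ sgn (z + + 1)
cassini = ℤ-induction (λ z → D z ≡ sgn (z + + 1)) refl up down
  where
  D : ℤ → ℤ
  D z = F z * F (z + + 2) - F (z + + 1) * F (z + + 1)

  D-suc : ∀ z → D (z + + 1) ≡ - D z
  D-suc z = begin
    b * F (z + + 1 + + 2) - F (z + + 1 + + 1) * F (z + + 1 + + 1)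
      ≡⟨ cong (λ c → b * c - F (z + + 1 + + 1) * F (z + + 1 + + 1)) (F-fibonacciLike (z + + 1)) ⟩
    b * (F (z + + 1 + + 1) + b) - F (z + + 1 + + 1) * F (z + + 1 + + 1)
      ≡⟨ cong (λ c → b * (c + b) - c * c) (trans (cong F (z+1+1≡z+2 z)) (F-fibonacciLike z)) ⟩
    b * ((b + a) + b) - (b + a) * (b + a)
      ≡⟨ alternate a b ⟩
    - (a * (b + a) - b * b)
      ≡⟨ cong (λ c → - (a * c - b * b)) (sym (F-fibonacciLike z)) ⟩
    - D z ∎
    where
    a = F z
    b = F (z + + 1)
    alternate : ∀ a b → b * ((b + a) + b) - (b + a) * (b + a) ≡ - (a * (b + a) - b * b)
    alternate = solve-∀

  up : ∀ z → D z ≡ sgn (z + + 1) → D (z + + 1) ≡ sgn (z + + 1 + + 1)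
  up z ih = trans (D-suc z) (trans (cong -_ ih) (sym (sgn-suc (z + + 1))))

  down : ∀ z → D (z + + 1) ≡ sgn (z + + 1 + + 1) → D z ≡ sgn (z + + 1)
  down z ih = begin
    D z                       ≡⟨ sym (ℤP.neg-involutive (D z)) ⟩
    - - D z                   ≡⟨ cong -_ (sym (D-suc z)) ⟩
    - D (z + + 1)             ≡⟨ cong -_ (trans ih (sgn-suc (z + + 1))) ⟩
    - - sgn (z + + 1)         ≡⟨ ℤP.neg-involutive (sgn (z + + 1)) ⟩
    sgn (z + + 1)             ∎

vajda : ∀ {f} → FibonacciLike f → ∀ u w p →
        F u * f (u + w + p) - F (u + w) * f (u + p) ≡ sgn (u + + 1) * F w * f p
vajda {f} f-fib u w p = begin
  F u * f (u + w + p) - F (u + w) * f (u + p)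
    ≡⟨ cong₂ (λ x y → a * x - F (u + w) * y) (fibonacciLike-addition f-fib (u + w) p) (fibonacciLike-addition f-fib u p) ⟩
  a * (F (u + w + + 1) * fp + F (u + w) * fp′) - F (u + w) * (b * fp + a * fp′)
    ≡⟨ cong (λ x → a * (x * fp + F (u + w) * fp′) - F (u + w) * (b * fp + a * fp′)) F[u+w+1] ⟩
  a * ((c * Fw + b * Fw′) * fp + F (u + w) * fp′) - F (u + w) * (b * fp + a * fp′)
    ≡⟨ cong (λ x → a * ((c * Fw + b * Fw′) * fp + x * fp′) - x * (b * fp + a * fp′)) (fibonacciLike-addition F-fibonacciLike u w) ⟩
  a * ((c * Fw + b * Fw′) * fp + (b * Fw + a * Fw′) * fp′) - (b * Fw + a * Fw′) * (b * fp + a * fp′)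
    ≡⟨ collect a b c Fw Fw′ fp fp′ ⟩
  (a * c - b * b) * Fw * fp
    ≡⟨ cong (λ x → x * Fw * fp) (cassini u) ⟩
  sgn (u + + 1) * F w * f p ∎
  where
  a = F u
  b = F (u + + 1)
  c = F (u + + 2)
  Fw = F w
  Fw′ = F (w - + 1)
  fp = f p
  fp′ = f (p - + 1)
  F[u+w+1] : F (u + w + + 1) ≡ c * Fw + b * Fw′
  F[u+w+1] = begin
    F (u + w + + 1)                  ≡⟨ cong F (swap u w (+ 1)) ⟩
    F (u + + 1 + w)                  ≡⟨ fibonacciLike-addition F-fibonacciLike (u + + 1) w ⟩
    F (u + + 1 + + 1) * Fw + b * Fw′ ≡⟨ cong (λ x → F x * Fw + b * Fw′) (z+1+1≡z+2 u) ⟩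
    c * Fw + b * Fw′                 ∎
    where
    swap : ∀ x a b → x + a + b ≡ x + b + a
    swap = solve-∀
  collect : ∀ a b c Fw Fw′ fp fp′ →
    a * ((c * Fw + b * Fw′) * fp + (b * Fw + a * Fw′) * fp′) - (b * Fw + a * Fw′) * (b * fp + a * fp′) ≡ (a * c - b * b) * Fw * fp
  collect = solve-∀

-- v stands for a - b + w and n₀ for the shifted start index of the numerators; both are kept as
-- variables, tied down by an equation, so that they can take the syntactic forms used in theorem6.
module TelescopingIdentities {f : ℤ → ℤ} (f-fib : FibonacciLike f) (a b w : ℤ) where

  relation₁ : ∀ {v} → a - b + w ≡ v → ∀ y → F (a - b) * f y - F v * f (y - w) ≡ sgn (a + b + + 1) * F w * f (y - v)
  relation₁ refl y = begin
    F (a - b) * f y - F (a - b + w) * f (y - w)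
      ≡⟨ cong₂ (λ i j → F (a - b) * f i - F (a - b + w) * f j) (sym (outer (a - b) w y)) (sym (inner (a - b) w y)) ⟩
    F (a - b) * f (a - b + w + (y - (a - b + w))) - F (a - b + w) * f (a - b + (y - (a - b + w)))
      ≡⟨ vajda {f} f-fib (a - b) w (y - (a - b + w)) ⟩
    sgn (a - b + + 1) * F w * f (y - (a - b + w))
      ≡⟨ cong (λ s → s * F w * f (y - (a - b + w))) (sgn[x-y+1]≡sgn[x+y+1] a b) ⟩
    sgn (a + b + + 1) * F w * f (y - (a - b + w)) ∎
    where
    outer : ∀ u w y → u + w + (y - (u + w)) ≡ y
    outer = solve-∀
    inner : ∀ u w y → u + (y - (u + w)) ≡ y - w
    inner = solve-∀

  relation₂ : ∀ {v} → a - b + w ≡ v → ∀ y → F (a - b) * f y - sgn (a + b + + 1) * F w * f (y - v) ≡ F v * f (y - w)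
  relation₂ a-b+w≡v y = i-j≡k⇒i-k≡j (F (a - b) * f y) (relation₁ a-b+w≡v y)

  relation₃ : ∀ {v} → a - b + w ≡ v → ∀ y → F v * f y - sgn (a + b) * F w * f (y - (a - b)) ≡ F (a - b) * f (y + w)
  relation₃ refl y = i-j≡-k⇒j-k≡i (sgn (a + b) * F w * f (y - (a - b))) (begin
    F (a - b) * f (y + w) - F (a - b + w) * f y
      ≡⟨ cong₂ (λ i j → F (a - b) * f i - F (a - b + w) * f j) (sym (outer (a - b) w y)) (sym (inner (a - b) y)) ⟩
    F (a - b) * f (a - b + w + (y - (a - b))) - F (a - b + w) * f (a - b + (y - (a - b)))
      ≡⟨ vajda {f} f-fib (a - b) w (y - (a - b)) ⟩
    sgn (a - b + + 1) * F w * f (y - (a - b))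
      ≡⟨ cong (λ s → s * F w * f (y - (a - b))) (trans (sgn-suc (a - b)) (cong -_ (sgn[x-y]≡sgn[x+y] a b))) ⟩
    - sgn (a + b) * F w * f (y - (a - b))
      ≡⟨ negate (sgn (a + b)) (F w) (f (y - (a - b))) ⟩
    - (sgn (a + b) * F w * f (y - (a - b))) ∎)
    where
    outer : ∀ u w y → u + w + (y - u) ≡ y + w
    outer = solve-∀
    inner : ∀ u y → u + (y - u) ≡ y
    inner = solve-∀
    negate : ∀ s c d → - s * c * d ≡ - (s * c * d)
    negate = solve-∀

  identity₁ : ∀ {v} → a - b + w ≡ v → ∀ {n₀} n k → n₀ ≡ n - v →
    (∀ j → j ≤ k → f (n - w * + k + w * + j) * f (n - w - w * + k + w * + j) ≢ + 0) →
    toℚ (sgn (a + b + + 1) * F w * f n * f (n - w * (+ k + + 1)))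
      ℚ.* Σ₀ k (λ j → (F (a - b) ^ (k ∸ j) * F v ^ j * f (n₀ - w * + k + w * + j))
                      ⊘ (f (n - w * + k + w * + j) * f (n - w - w * + k + w * + j)))
    ≡ toℚ (F (a - b) ^ suc k * f n - F v ^ suc k * f (n - w * (+ k + + 1)))
  identity₁ {v} a-b+w≡v n k n₀≡n-v =
    telescoping-identity f (λ y → f (y - v)) (sgn (a + b + + 1) * F w) (F (a - b)) (F v) w n k (relation₁ a-b+w≡v)
      (λ j → cong (λ i → F (a - b) ^ (k ∸ j) * F v ^ j * f i) (reindex n (- v) n₀≡n-v w (+ k) (+ j)))

  identity₂ : ∀ {v} → a - b + w ≡ v → ∀ {n₀} n k → n₀ ≡ n - w →
    (∀ j → j ≤ k → f (n - v * + k + v * + j) * f (n - v - v * + k + v * + j) ≢ + 0) →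
    toℚ (F v * f n * f (n - v * (+ k + + 1)))
      ℚ.* Σ₀ k (λ j → (sgn ((a + b + + 1) * + j) * F (a - b) ^ (k ∸ j) * F w ^ j * f (n₀ - v * + k + v * + j))
                      ⊘ (f (n - v * + k + v * + j) * f (n - v - v * + k + v * + j)))
    ≡ toℚ (F (a - b) ^ suc k * f n - sgn ((a + b + + 1) * (+ k + + 1)) * F w ^ suc k * f (n - v * (+ k + + 1)))
  identity₂ {v} a-b+w≡v n k n₀≡n-w nonzero = trans
    (telescoping-identity f (λ y → f (y - w)) (F v) (F (a - b)) (sgn (a + b + + 1) * F w) v n k (relation₂ a-b+w≡v)
      (λ j → cong₂ _*_ (signed-weight (a + b + + 1) (F (a - b) ^ (k ∸ j)) (F w) j) (cong f (reindex n (- w) n₀≡n-w v (+ k) (+ j))))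
      nonzero)
    (cong (λ t → toℚ (F (a - b) ^ suc k * f n - t * f (n - v * (+ k + + 1)))) (sym (signed-power (a + b + + 1) (F w) k)))

  identity₃ : ∀ {v} → a - b + w ≡ v → ∀ {n₀} n k → n₀ ≡ n + w →
    (∀ j → j ≤ k → f (n - (a - b) * + k + (a - b) * + j) * f (n - (a - b) - (a - b) * + k + (a - b) * + j) ≢ + 0) →
    toℚ (F (a - b) * f n * f (n - (a - b) * (+ k + + 1)))
      ℚ.* Σ₀ k (λ j → (sgn ((a + b) * + j) * F v ^ (k ∸ j) * F w ^ j * f (n₀ - (a - b) * + k + (a - b) * + j))
                      ⊘ (f (n - (a - b) * + k + (a - b) * + j) * f (n - (a - b) - (a - b) * + k + (a - b) * + j)))
    ≡ toℚ (F v ^ suc k * f n - sgn ((a + b) * (+ k + + 1)) * F w ^ suc k * f (n - (a - b) * (+ k + + 1)))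
  identity₃ {v} a-b+w≡v n k n₀≡n+w nonzero = trans
    (telescoping-identity f (λ y → f (y + w)) (F (a - b)) (F v) (sgn (a + b) * F w) (a - b) n k (relation₃ a-b+w≡v)
      (λ j → cong₂ _*_ (signed-weight (a + b) (F v ^ (k ∸ j)) (F w) j) (cong f (reindex n w n₀≡n+w (a - b) (+ k) (+ j))))
      nonzero)
    (cong (λ t → toℚ (F v ^ suc k * f n - t * f (n - (a - b) * (+ k + + 1)))) (sym (signed-power (a + b) (F w) k)))

theorem6 : (g0 g1 : ℤ) → ¬ (g0 ≡ + 0 × g1 ≡ + 0) → (a b m n : ℤ) → (k : ℕ) →
  let Gs = G g0 g1
      K = + k
  in
  -- (1)  d = m - a
  ((∀ j → j ≤ k → Gs (n - (m - a) * K + (m - a) * + j) * Gs (n - (m - a) - (m - a) * K + (m - a) * + j) ≢ + 0) →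
    toℚ (sgn (a + b + + 1) * F (m - a) * Gs n * Gs (n - (m - a) * (K + + 1)))
      ℚ.* Σ₀ k (λ j → (F (a - b) ^ (k ∸ j) * F (m - b) ^ j * Gs (n - m + b - (m - a) * K + (m - a) * + j))
                      ⊘ (Gs (n - (m - a) * K + (m - a) * + j) * Gs (n - (m - a) - (m - a) * K + (m - a) * + j)))
    ≡ toℚ (F (a - b) ^ ℕ.suc k * Gs n - F (m - b) ^ ℕ.suc k * Gs (n - (m - a) * (K + + 1)))) ×
  -- (2)  d = m - b
  ((∀ j → j ≤ k → Gs (n - (m - b) * K + (m - b) * + j) * Gs (n - (m - b) - (m - b) * K + (m - b) * + j) ≢ + 0) →
    toℚ (F (m - b) * Gs n * Gs (n - (m - b) * (K + + 1)))
      ℚ.* Σ₀ k (λ j → (sgn ((a + b + + 1) * + j) * F (a - b) ^ (k ∸ j) * F (m - a) ^ j * Gs (n - (m - a) - (m - b) * K + (m - b) * + j))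
                      ⊘ (Gs (n - (m - b) * K + (m - b) * + j) * Gs (n - (m - b) - (m - b) * K + (m - b) * + j)))
    ≡ toℚ (F (a - b) ^ ℕ.suc k * Gs n - sgn ((a + b + + 1) * (K + + 1)) * F (m - a) ^ ℕ.suc k * Gs (n - (m - b) * (K + + 1)))) ×
  -- (3)  d = a - b
  ((∀ j → j ≤ k → Gs (n - (a - b) * K + (a - b) * + j) * Gs (n - (a - b) - (a - b) * K + (a - b) * + j) ≢ + 0) →
    toℚ (F (a - b) * Gs n * Gs (n - (a - b) * (K + + 1)))
      ℚ.* Σ₀ k (λ j → (sgn ((a + b) * + j) * F (m - b) ^ (k ∸ j) * F (m - a) ^ j * Gs (n + m - a - (a - b) * K + (a - b) * + j))
                      ⊘ (Gs (n - (a - b) * K + (a - b) * + j) * Gs (n - (a - b) - (a - b) * K + (a - b) * + j)))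
    ≡ toℚ (F (m - b) ^ ℕ.suc k * Gs n - sgn ((a + b) * (K + + 1)) * F (m - a) ^ ℕ.suc k * Gs (n - (a - b) * (K + + 1)))) ×
  -- (4)  d = m + b
  ((∀ j → j ≤ k → Gs (n - (m + b) * K + (m + b) * + j) * Gs (n - (m + b) - (m + b) * K + (m + b) * + j) ≢ + 0) →
    toℚ (sgn (a + b + + 1) * F (m + b) * Gs n * Gs (n - (m + b) * (K + + 1)))
      ℚ.* Σ₀ k (λ j → (F (a - b) ^ (k ∸ j) * F (m + a) ^ j * Gs (n - m - a - (m + b) * K + (m + b) * + j))
                      ⊘ (Gs (n - (m + b) * K + (m + b) * + j) * Gs (n - (m + b) - (m + b) * K + (m + b) * + j)))
    ≡ toℚ (F (a - b) ^ ℕ.suc k * Gs n - F (m + a) ^ ℕ.suc k * Gs (n - (m + b) * (K + + 1)))) ×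
  -- (5)  d = m + a
  ((∀ j → j ≤ k → Gs (n - (m + a) * K + (m + a) * + j) * Gs (n - (m + a) - (m + a) * K + (m + a) * + j) ≢ + 0) →
    toℚ (F (m + a) * Gs n * Gs (n - (m + a) * (K + + 1)))
      ℚ.* Σ₀ k (λ j → (sgn ((a + b + + 1) * + j) * F (a - b) ^ (k ∸ j) * F (m + b) ^ j * Gs (n - (m + b) - (m + a) * K + (m + a) * + j))
                      ⊘ (Gs (n - (m + a) * K + (m + a) * + j) * Gs (n - (m + a) - (m + a) * K + (m + a) * + j)))
    ≡ toℚ (F (a - b) ^ ℕ.suc k * Gs n - sgn ((a + b + + 1) * (K + + 1)) * F (m + b) ^ ℕ.suc k * Gs (n - (m + a) * (K + + 1)))) ×
  -- (6)  d = a - b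
  ((∀ j → j ≤ k → Gs (n - (a - b) * K + (a - b) * + j) * Gs (n - (a - b) - (a - b) * K + (a - b) * + j) ≢ + 0) →
    toℚ (F (a - b) * Gs n * Gs (n - (a - b) * (K + + 1)))
      ℚ.* Σ₀ k (λ j → (sgn ((a + b) * + j) * F (m + a) ^ (k ∸ j) * F (m + b) ^ j * Gs (n + m + b - (a - b) * K + (a - b) * + j))
                      ⊘ (Gs (n - (a - b) * K + (a - b) * + j) * Gs (n - (a - b) - (a - b) * K + (a - b) * + j)))
    ≡ toℚ (F (m + a) ^ ℕ.suc k * Gs n - sgn ((a + b) * (K + + 1)) * F (m + b) ^ ℕ.suc k * Gs (n - (a - b) * (K + + 1))))
theorem6 g0 g1 _ a b m n k =
    Vₘ₋ₐ.identity₁ (a-b+[m-a]≡m-b a b m) n k (n-m+b≡n-[m-b] n m b)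
  , Vₘ₋ₐ.identity₂ (a-b+[m-a]≡m-b a b m) n k refl
  , Vₘ₋ₐ.identity₃ (a-b+[m-a]≡m-b a b m) n k (ℤP.+-assoc n m (- a))
  , Vₘ₊ᵦ.identity₁ (a-b+[m+b]≡m+a a b m) n k (n-m-a≡n-[m+a] n m a)
  , Vₘ₊ᵦ.identity₂ (a-b+[m+b]≡m+a a b m) n k refl
  , Vₘ₊ᵦ.identity₃ (a-b+[m+b]≡m+a a b m) n k (ℤP.+-assoc n m b)
  where
  module Vₘ₋ₐ = TelescopingIdentities {G g0 g1} (G-fibonacciLike g0 g1) a b (m - a)
  module Vₘ₊ᵦ = TelescopingIdentities {G g0 g1} (G-fibonacciLike g0 g1) a b (m + b)

  a-b+[m-a]≡m-b : ∀ a b m → a - b + (m - a) ≡ m - b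
  a-b+[m-a]≡m-b = solve-∀
  a-b+[m+b]≡m+a : ∀ a b m → a - b + (m + b) ≡ m + a
  a-b+[m+b]≡m+a = solve-∀
  n-m+b≡n-[m-b] : ∀ n m b → n - m + b ≡ n - (m - b)
  n-m+b≡n-[m-b] = solve-∀
  n-m-a≡n-[m+a] : ∀ n m a → n - m - a ≡ n - (m + a)
  n-m-a≡n-[m+a] = solve-∀
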